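{- For every integer $n\geq 4$, \[|\mathrm{VPF}_n^{\downarrow}| = 2\,|\mathrm{VPF}_{n-1}^{\downarrow}| + |\mathrm{VPF}_{n-3}^{\downarrow}|,\] and $|\mathrm{VPF}_1^{\downarrow}|=1$, $|\mathrm{VPF}_2^{\downarrow}|=3$, $|\mathrm{VPF}_3^{\downarrow}|=6$.
   Context: For $n\in\mathbb{N}$ let $[n]=\{1,\dots,n\}$. A preference list $\alpha=(a_1,\dots,a_n)\in[n]^n$ describes $n$ cars entering, in order $i=1,\dots,n$, a one-way street with spots $1,\dots,n$; car $i$ prefers spot $a_i$. Under the vacillating parking rule, car $i$ parks in spot $a_i$ if unoccupied; otherwise in spot $a_i-1$ if it exists and is unoccupied; otherwise in spot $a_i+1$ if it exists and is unoccupied; otherwise it fails to park. If all cars park, $\alpha$ is a vacillating parking function of length $n$. $\mathrm{VPF}_n^{\downarrow}$ denotes the set of vacillating parking functions $(b_1,\dots,b_n)$ of length $n$ with $b_1\geq b_2\geq\cdots\geq b_n$. -}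

module Defs where

open import Data.Nat using (ℕ; zero; suc; _≤_; _≥_; _∸_; _+_; _≤ᵇ_; _≡ᵇ_)
open import Data.Bool using (Bool; true; false; if_then_else_; _∧_; not)
open import Data.List using (List; []; _∷_)
open import Data.Bool.ListAction using (any)
open import Data.Vec using (Vec; toList)
open import Data.Vec.Relation.Unary.All using (All)
open import Data.List.Relation.Unary.Linked using (Linked)
open import Data.Product using (Σ; _×_)
open import Relation.Binary.PropositionalEquality using (_≡_)

occupied : ℕ → List ℕ → Bool
occupied s occ = any (λ t → s ≡ᵇ t) occ

vacPark : ℕ → List ℕ → List ℕ → Bool
vacPark n occ [] = true
vacPark n occ (a ∷ as) =
  if not (occupied a occ) then vacPark n (a ∷ occ) as
  else if (2 ≤ᵇ a) ∧ not (occupied (a ∸ 1) occ) then vacPark n ((a ∸ 1) ∷ occ) as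
  else if (suc a ≤ᵇ n) ∧ not (occupied (suc a) occ) then vacPark n (suc a ∷ occ) as
  else false

InRange : ℕ → ℕ → Set
InRange n a = (1 ≤ a) × (a ≤ n)

IsVPF : (n : ℕ) → Vec ℕ n → Set
IsVPF n α = All (InRange n) α × (vacPark n [] (toList α) ≡ true)

Decreasing : ∀ {n} → Vec ℕ n → Set
Decreasing α = Linked _≥_ (toList α)

VPFdown : ℕ → Set
VPFdown n = Σ (Vec ℕ n) (λ α → IsVPF n α × Decreasing α)

{-# OPTIONS --safe #-}
module Submission where

open import Defs
open import Axiom.UniquenessOfIdentityProofs using (module Decidable⇒UIP)
open import Data.Bool using (Bool; true; false; not; _∧_; T; if_then_else_)
import Data.Bool.Properties as Bool
open import Data.Bool.Properties using (T-∧; T-≡; T-not-≡; T-irrelevant; ∧-zeroʳ; not-injective)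
open import Data.Empty using (⊥-elim)
open import Data.Fin using (Fin; zero)
open import Data.Fin.Permutation using (↔⇒≡)
open import Data.Fin.Properties using (+↔⊎)
open import Data.List using (List; []; _∷_)
open import Data.List.Membership.Propositional using (_∈_; _∉_)
open import Data.List.Relation.Unary.Any using (here; there)
import Data.List.Relation.Unary.Any as Any
open import Data.List.Relation.Unary.Any.Properties using (any⁺; any⁻)
open import Data.List.Relation.Unary.Linked using (Linked; [-]; _∷_)
import Data.List.Relation.Unary.Linked as Linked
open import Data.Maybe using (Maybe; just; nothing; maybe′)
open import Data.Nat using (ℕ; zero; suc; _≤_; _<_; _≰_; _≥_; _+_; _*_; _∸_; _≤ᵇ_; _≡ᵇ_; z≤n; s≤s)
open import Data.Nat.Properties
  using (_≟_; _≤?_; ≤-refl; ≤-reflexive; ≤-trans; ≤-irrelevant; ≰⇒>; <⇒≱; <⇒≢; ≤∧≢⇒<; ≤-pred; 1+n≰n;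
         m≤n⇒m≤1+n; n≤1+n; m≤n+m; m∸n≤m; ∸-monoˡ-≤; suc-injective; ≤ᵇ⇒≤; ≤⇒≤ᵇ; ≤ᵇ-reflects-≤; ≡⇒≡ᵇ; ≡ᵇ⇒≡)
open import Data.Nat.Tactic.RingSolver using (solve-∀)
open import Data.Product using (Σ; _×_; _,_; proj₁; proj₂; map₂)
open import Data.Sum using (_⊎_; inj₁; inj₂; [_,_]′)
open import Data.Sum.Function.Propositional using (_⊎-↔_)
open import Data.Vec using (Vec; []; _∷_; toList; head)
open import Data.Vec.Relation.Unary.All using (All; []; _∷_)
import Data.Vec.Relation.Unary.All as All
open import Function using (_∘_; id)
open import Function.Bundles using (Equivalence; _↔_; mk↔ₛ′)
open import Function.Properties.Inverse using (↔-trans; ↔-sym)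
open import Function.Related.Propositional using (module EquationalReasoning; bijection)
open import Relation.Nullary using (¬_; yes; no; ofʸ; contradiction)
open import Relation.Binary.PropositionalEquality using (_≡_; _≢_; _≗_; refl; sym; trans; cong; cong₂; subst)

-- Cars arrive in weakly decreasing order of preference, so a car preferring b parks in b-1, b or b+1, and
-- for the later cars, which prefer at most b, only the set of available spots matters.  Let v n = |VPF↓ n|
-- and let t m count the decreasing preference lists of length m that park on the street 1..m+1 whose top
-- spot is already taken.  Splitting on whether the first car prefers the largest admissible value gives
-- t (m+1) = t m + v (m+1) and v (j+3) = t (j+2) + t j.  In the second summand of the latter no car prefers
-- j+3; since cars preferring at most p only reach spots 1..p+1, counting free spots forces the first three
-- cars to prefer j+2, parking in j+2, j+1 and j+3, and the rest see a street 1..j+1 with its top taken.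
-- Eliminating t gives v (j+4) = 2 v (j+3) + v (j+1).

≡ᵇ-refl : ∀ n → (n ≡ᵇ n) ≡ true
≡ᵇ-refl n = Equivalence.to T-≡ (≡⇒≡ᵇ n n refl)

≢⇒≡ᵇ≡false : ∀ {m n} → m ≢ n → (m ≡ᵇ n) ≡ false
≢⇒≡ᵇ≡false {m} {n} m≢n with m ≡ᵇ n in m≡ᵇn
... | true = contradiction (≡ᵇ⇒≡ m n (subst T (sym m≡ᵇn) _)) m≢n
... | false = refl

≤⇒≤ᵇ≡true : ∀ {m n} → m ≤ n → (m ≤ᵇ n) ≡ true
≤⇒≤ᵇ≡true m≤n = Equivalence.to T-≡ (≤⇒≤ᵇ m≤n)

≰⇒≤ᵇ≡false : ∀ {m n} → m ≰ n → (m ≤ᵇ n) ≡ false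
≰⇒≤ᵇ≡false {m} {n} m≰n with m ≤ᵇ n | ≤ᵇ-reflects-≤ m n
... | true | ofʸ m≤n = contradiction m≤n m≰n
... | false | _ = refl

≤ᵇ-suc : ∀ {m n} → m ≢ suc n → (m ≤ᵇ suc n) ≡ (m ≤ᵇ n)
≤ᵇ-suc {m} {n} m≢1+n with m ≤? n
... | yes m≤n = trans (≤⇒≤ᵇ≡true (m≤n⇒m≤1+n m≤n)) (sym (≤⇒≤ᵇ≡true m≤n))
... | no m≰n = trans (≰⇒≤ᵇ≡false (λ m≤1+n → m≰n (≤-pred (≤∧≢⇒< m≤1+n m≢1+n)))) (sym (≰⇒≤ᵇ≡false m≰n))

∈⇒occupied : ∀ {s} occ → s ∈ occ → occupied s occ ≡ true
∈⇒occupied {s} occ s∈occ = Equivalence.to T-≡ (any⁺ (s ≡ᵇ_) (Any.map (≡⇒≡ᵇ s _) s∈occ))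

∉⇒unoccupied : ∀ s occ → s ∉ occ → occupied s occ ≡ false
∉⇒unoccupied s occ s∉occ with occupied s occ in occ-s
... | true = contradiction (Any.map (≡ᵇ⇒≡ s _) (any⁻ (s ≡ᵇ_) occ (subst T (sym occ-s) _))) s∉occ
... | false = refl

occupied-there : ∀ {s t} occ → s ≢ t → occupied s (t ∷ occ) ≡ occupied s occ
occupied-there occ s≢t rewrite ≢⇒≡ᵇ≡false s≢t = refl

available : ℕ → List ℕ → ℕ → Bool
available n occ s = (s ≤ᵇ n) ∧ not (occupied s occ)

available-≤ : ∀ {n s} occ → s ≤ n → available n occ s ≡ not (occupied s occ)
available-≤ occ s≤n rewrite ≤⇒≤ᵇ≡true s≤n = refl

available-> : ∀ {n s} occ → n < s → available n occ s ≡ false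
available-> occ n<s rewrite ≰⇒≤ᵇ≡false (<⇒≱ n<s) = refl

available⇒unoccupied : ∀ n occ s → available n occ s ≡ true → occupied s occ ≡ false
available⇒unoccupied n occ s avail =
  Equivalence.to T-not-≡ (proj₂ (Equivalence.to T-∧ (Equivalence.from T-≡ avail)))

occupied-cong : ∀ {n n′} occ occ′ {s} → available n occ ≗ available n′ occ′ → s ≤ n → s ≤ n′ →
                occupied s occ ≡ occupied s occ′
occupied-cong occ occ′ {s} same s≤n s≤n′ =
  not-injective (trans (sym (available-≤ occ s≤n)) (trans (same s) (available-≤ occ′ s≤n′)))

available-∷ : ∀ {n n′} occ occ′ t → available n occ ≗ available n′ occ′ →
              available n (t ∷ occ) ≗ available n′ (t ∷ occ′)
available-∷ {n} {n′} occ occ′ t same s with s ≡ᵇ t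
... | true = trans (∧-zeroʳ (s ≤ᵇ n)) (sym (∧-zeroʳ (s ≤ᵇ n′)))
... | false = same s

available-top∷ : ∀ n occ → available (suc n) (suc n ∷ occ) ≗ available n occ
available-top∷ n occ s with s ≤? n
... | yes s≤n = trans (available-≤ (suc n ∷ occ) (m≤n⇒m≤1+n s≤n))
                  (trans (cong not (occupied-there occ (<⇒≢ (s≤s s≤n)))) (sym (available-≤ occ s≤n)))
... | no s≰n with s ≟ suc n
...   | yes refl = trans (available-≤ (suc n ∷ occ) (≤-refl {suc n}))
                     (trans (cong not (∈⇒occupied (suc n ∷ occ) (here refl)))
                            (sym (available-> occ (≤-refl {suc n}))))
...   | no s≢1+n = trans (available-> (suc n ∷ occ) (≤∧≢⇒< (≰⇒> s≰n) (s≢1+n ∘ sym)))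
                         (sym (available-> occ (≰⇒> s≰n)))

parkingSpot : ℕ → List ℕ → ℕ → Maybe ℕ
parkingSpot n occ a =
  if not (occupied a occ) then just a
  else if (2 ≤ᵇ a) ∧ not (occupied (a ∸ 1) occ) then just (a ∸ 1)
  else if available n occ (suc a) then just (suc a)
  else nothing

vacPark-∷ : ∀ n occ a as →
            vacPark n occ (a ∷ as) ≡ maybe′ (λ s → vacPark n (s ∷ occ) as) false (parkingSpot n occ a)
vacPark-∷ n occ a as with not (occupied a occ) | (2 ≤ᵇ a) ∧ not (occupied (a ∸ 1) occ) | available n occ (suc a)
... | true | _ | _ = refl
... | false | true | _ = refl
... | false | false | true = refl
... | false | false | false = refl

vacPark-park : ∀ n occ {a s} as → parkingSpot n occ a ≡ just s → vacPark n occ (a ∷ as) ≡ vacPark n (s ∷ occ) as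
vacPark-park n occ {a} as spot rewrite vacPark-∷ n occ a as | spot = refl

vacPark-stuck : ∀ n occ {a} as → parkingSpot n occ a ≡ nothing → vacPark n occ (a ∷ as) ≡ false
vacPark-stuck n occ {a} as spot rewrite vacPark-∷ n occ a as | spot = refl

parkingSpot-cong : ∀ {n n′} occ occ′ {a} → available n occ ≗ available n′ occ′ → a ≤ n → a ≤ n′ →
                   parkingSpot n occ a ≡ parkingSpot n′ occ′ a
parkingSpot-cong occ occ′ {a} same a≤n a≤n′
  rewrite occupied-cong occ occ′ same a≤n a≤n′
        | occupied-cong occ occ′ same (≤-trans (m∸n≤m a 1) a≤n) (≤-trans (m∸n≤m a 1) a≤n′)
        | same (suc a) = refl

parkingSpot-sound : ∀ n occ {a s} → 1 ≤ a → parkingSpot n occ a ≡ just s →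
                    occupied s occ ≡ false × 1 ≤ s × s ≤ suc a
parkingSpot-sound n occ {a} 1≤a spot
  with occupied a occ in occ-a | 2 ≤ᵇ a in 2≤ᵇa | occupied (a ∸ 1) occ in occ-a-1 | available n occ (suc a) in avail
parkingSpot-sound _ _ 1≤a refl | false | _ | _ | _ = occ-a , 1≤a , n≤1+n _
parkingSpot-sound _ _ {a} _ refl | true | true | false | _ =
  occ-a-1 , ∸-monoˡ-≤ 1 (≤ᵇ⇒≤ 2 a (Equivalence.from T-≡ 2≤ᵇa)) , ≤-trans (m∸n≤m a 1) (n≤1+n a)
parkingSpot-sound n occ {a} _ refl | true | true | true | true =
  available⇒unoccupied n occ (suc a) avail , s≤s z≤n , ≤-refl
parkingSpot-sound n occ {a} _ refl | true | false | _ | true =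
  available⇒unoccupied n occ (suc a) avail , s≤s z≤n , ≤-refl

parkingSpot-left : ∀ n occ a → suc (suc a) ∈ occ → suc a ∉ occ → parkingSpot n occ (suc (suc a)) ≡ just (suc a)
parkingSpot-left n occ a 2+a∈occ 1+a∉occ rewrite ∈⇒occupied occ 2+a∈occ | ∉⇒unoccupied (suc a) occ 1+a∉occ = refl

parkingSpot-right : ∀ n occ a → suc (suc a) ∈ occ → suc a ∈ occ → suc (suc (suc a)) ≤ n → suc (suc (suc a)) ∉ occ →
                    parkingSpot n occ (suc (suc a)) ≡ just (suc (suc (suc a)))
parkingSpot-right n occ a 2+a∈occ 1+a∈occ 3+a≤n 3+a∉occ
  rewrite ∈⇒occupied occ 2+a∈occ | ∈⇒occupied occ 1+a∈occ | available-≤ occ 3+a≤n | ∉⇒unoccupied _ occ 3+a∉occ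
  = refl

parkingSpot-stuck : ∀ n occ a → suc (suc a) ∈ occ → suc a ∈ occ → available n occ (suc (suc (suc a))) ≡ false →
                    parkingSpot n occ (suc (suc a)) ≡ nothing
parkingSpot-stuck n occ a 2+a∈occ 1+a∈occ unavailable
  rewrite ∈⇒occupied occ 2+a∈occ | ∈⇒occupied occ 1+a∈occ | unavailable = refl

desc≤ : ∀ {k} → ℕ → Vec ℕ k → Bool
desc≤ b [] = true
desc≤ b (x ∷ v) = (1 ≤ᵇ x) ∧ (x ≤ᵇ b) ∧ desc≤ x v

desc≤-∷⁻ : ∀ {k b x} (v : Vec ℕ k) → T (desc≤ b (x ∷ v)) → 1 ≤ x × x ≤ b × T (desc≤ x v)
desc≤-∷⁻ {b = b} {x} v d with Equivalence.to T-∧ d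
... | 1≤ᵇx , d′ with Equivalence.to T-∧ d′
...   | x≤ᵇb , dv = ≤ᵇ⇒≤ 1 x 1≤ᵇx , ≤ᵇ⇒≤ x b x≤ᵇb , dv

desc≤-sound : ∀ {k b} (v : Vec ℕ k) → T (desc≤ b v) → All (InRange b) v × Linked _≥_ (b ∷ toList v)
desc≤-sound [] _ = [] , [-]
desc≤-sound (x ∷ v) d with desc≤-∷⁻ v d
... | 1≤x , x≤b , dv with desc≤-sound v dv
...   | inRange , linked = (1≤x , x≤b) ∷ All.map (map₂ (λ y≤x → ≤-trans y≤x x≤b)) inRange , x≤b ∷ linked

desc≤-complete : ∀ {k b} {v : Vec ℕ k} → All (1 ≤_) v → Linked _≥_ (b ∷ toList v) → T (desc≤ b v)
desc≤-complete [] _ = _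
desc≤-complete (1≤x ∷ pos) (x≤b ∷ linked) =
  Equivalence.from T-∧ (≤⇒≤ᵇ 1≤x , Equivalence.from T-∧ (≤⇒≤ᵇ x≤b , desc≤-complete pos linked))

vacPark-cong : ∀ {k b n n′} occ occ′ → available n occ ≗ available n′ occ′ → b ≤ n → b ≤ n′ →
               (v : Vec ℕ k) → T (desc≤ b v) → vacPark n occ (toList v) ≡ vacPark n′ occ′ (toList v)
vacPark-cong occ occ′ same b≤n b≤n′ [] _ = refl
vacPark-cong {n = n} {n′} occ occ′ same b≤n b≤n′ (x ∷ v) d
  with _ , x≤b , dv ← desc≤-∷⁻ v d
  with x≤n ← ≤-trans x≤b b≤n | x≤n′ ← ≤-trans x≤b b≤n′
  with spot≡spot′ ← parkingSpot-cong occ occ′ same x≤n x≤n′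
  with parkingSpot n′ occ′ x in spot′
... | nothing =
  trans (vacPark-stuck n occ (toList v) (trans spot≡spot′ spot′)) (sym (vacPark-stuck n′ occ′ (toList v) spot′))
... | just s =
  trans (vacPark-park n occ (toList v) (trans spot≡spot′ spot′))
        (trans (vacPark-cong (s ∷ occ) (s ∷ occ′) (available-∷ occ occ′ s same) x≤n x≤n′ v dv)
               (sym (vacPark-park n′ occ′ (toList v) spot′)))

free : ℕ → List ℕ → ℕ
free zero occ = 0
free (suc p) occ = if occupied (suc p) occ then free p occ else suc (free p occ)

free-[] : ∀ p → free p [] ≡ p
free-[] zero = refl
free-[] (suc p) = cong suc (free-[] p)

free-beyond : ∀ p {t} occ → p < t → free p (t ∷ occ) ≡ free p occ
free-beyond zero occ _ = refl
free-beyond (suc p) occ p<t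
  rewrite occupied-there occ (<⇒≢ p<t) | free-beyond p occ (≤-trans (n≤1+n _) p<t) = refl

free-park : ∀ p s occ → 1 ≤ s → s ≤ p → occupied s occ ≡ false → free p occ ≡ suc (free p (s ∷ occ))
free-park zero _ occ (s≤s _) ()
free-park (suc p) s occ 1≤s s≤1+p s-free with s ≟ suc p
... | yes refl rewrite ∈⇒occupied (suc p ∷ occ) (here refl) | s-free = cong suc (sym (free-beyond p occ ≤-refl))
... | no s≢1+p
  rewrite occupied-there occ (s≢1+p ∘ sym) | free-park p s occ 1≤s (≤-pred (≤∧≢⇒< s≤1+p s≢1+p)) s-free
  with occupied (suc p) occ
...   | true = refl
...   | false = refl

parked≤free : ∀ {k b p n occ} (v : Vec ℕ k) → b ≤ p → T (desc≤ b v) → T (vacPark n occ (toList v)) →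
              k ≤ free (suc p) occ
parked≤free [] _ _ _ = z≤n
parked≤free {suc k} {p = p} {n} {occ} (x ∷ v) b≤p d parks
  with 1≤x , x≤b , dv ← desc≤-∷⁻ v d
  with parkingSpot n occ x in spot
... | nothing = ⊥-elim (subst T (vacPark-stuck n occ (toList v) spot) parks)
... | just s with s-free , 1≤s , s≤1+x ← parkingSpot-sound n occ 1≤x spot =
  subst (suc k ≤_) (sym (free-park (suc p) s occ 1≤s (≤-trans s≤1+x (s≤s (≤-trans x≤b b≤p))) s-free))
    (s≤s (parked≤free v (≤-trans x≤b b≤p) dv (subst T (vacPark-park n occ (toList v) spot) parks)))

Sub : (k : ℕ) → (Vec ℕ k → Bool) → Set
Sub k P = Σ (Vec ℕ k) (T ∘ P)

Sub-≡ : ∀ {k P} {x y : Sub k P} → proj₁ x ≡ proj₁ y → x ≡ y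
Sub-≡ {x = v , p} {.v , q} refl = cong (v ,_) (T-irrelevant p q)

Sub-cong : ∀ {k} {P Q : Vec ℕ k → Bool} → P ≗ Q → Sub k P ↔ Sub k Q
Sub-cong P≗Q = mk↔ₛ′ (map₂ (subst T (P≗Q _))) (map₂ (subst T (sym (P≗Q _)))) (λ _ → Sub-≡ refl) (λ _ → Sub-≡ refl)

Sub-∷ : ∀ {k} {P : Vec ℕ (suc k) → Bool} c →
        Sub (suc k) P ↔ (Sub k (P ∘ (c ∷_)) ⊎ Sub (suc k) (λ v → not (head v ≡ᵇ c) ∧ P v))
Sub-∷ {k} {P} c = mk↔ₛ′ to from to∘from from∘to
  where
  to : Sub (suc k) P → Sub k (P ∘ (c ∷_)) ⊎ Sub (suc k) (λ v → not (head v ≡ᵇ c) ∧ P v)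
  to (x ∷ v , p) with x ≟ c
  ... | yes refl = inj₁ (v , p)
  ... | no x≢c = inj₂ (x ∷ v , subst (λ b → T (not b ∧ P (x ∷ v))) (sym (≢⇒≡ᵇ≡false x≢c)) p)
  from : Sub k (P ∘ (c ∷_)) ⊎ Sub (suc k) (λ v → not (head v ≡ᵇ c) ∧ P v) → Sub (suc k) P
  from (inj₁ (v , p)) = c ∷ v , p
  from (inj₂ (v , q)) = v , proj₂ (Equivalence.to T-∧ q)
  to∘from : ∀ y → to (from y) ≡ y
  to∘from (inj₁ (v , p)) with c ≟ c
  ... | yes refl = refl
  ... | no c≢c = contradiction refl c≢c
  to∘from (inj₂ (x ∷ v , q)) with x ≟ c
  ... | yes refl =
    ⊥-elim (subst T (trans (sym (≡ᵇ-refl x)) (Equivalence.to T-not-≡ (proj₁ (Equivalence.to T-∧ q)))) _)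
  ... | no _ = cong inj₂ (Sub-≡ refl)
  from∘to : ∀ x → from (to x) ≡ x
  from∘to (x ∷ v , p) with x ≟ c
  ... | yes refl = refl
  ... | no _ = Sub-≡ refl

⊎-emptyʳ : ∀ {A B : Set} → ¬ B → (A ⊎ B) ↔ A
⊎-emptyʳ ¬b = mk↔ₛ′ [ id , ⊥-elim ∘ ¬b ]′ inj₁ (λ _ → refl) λ { (inj₁ _) → refl ; (inj₂ b) → ⊥-elim (¬b b) }

⊎-Fin : ∀ {A B : Set} {a b} → A ↔ Fin a → B ↔ Fin b → (A ⊎ B) ↔ Fin (a + b)
⊎-Fin A↔a B↔b = ↔-trans (A↔a ⊎-↔ B↔b) (↔-sym +↔⊎)

-- DescPF k b n occ: the weakly decreasing lists of k preferences in [1, b] all of whose cars park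
-- under the vacillating rule on the street 1..n whose spots occ are already taken.
parksDesc : ∀ {k} → ℕ → ℕ → List ℕ → Vec ℕ k → Bool
parksDesc b n occ v = desc≤ b v ∧ vacPark n occ (toList v)

DescPF : ℕ → ℕ → ℕ → List ℕ → Set
DescPF k b n occ = Sub k (parksDesc b n occ)

parksDesc-top : ∀ {k b} n occ {s} → parkingSpot n occ (suc b) ≡ just s →
                (v : Vec ℕ k) → parksDesc (suc b) n occ (suc b ∷ v) ≡ parksDesc (suc b) n (s ∷ occ) v
parksDesc-top {b = b} n occ spot v rewrite ≤⇒≤ᵇ≡true (≤-refl {suc b}) | vacPark-park n occ (toList v) spot = refl

parksDesc-below : ∀ {k b} n occ x (v : Vec ℕ k) →
                  not (x ≡ᵇ suc b) ∧ parksDesc (suc b) n occ (x ∷ v) ≡ parksDesc b n occ (x ∷ v)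
parksDesc-below {b = b} n occ x v with x ≟ suc b
... | yes refl rewrite ≡ᵇ-refl (suc b) | ≰⇒≤ᵇ≡false (1+n≰n {b}) = refl
... | no x≢1+b rewrite ≢⇒≡ᵇ≡false x≢1+b | ≤ᵇ-suc x≢1+b = refl

parksDesc-stuck : ∀ {k b} n occ → parkingSpot n occ (suc b) ≡ nothing →
                  (v : Vec ℕ k) → parksDesc (suc b) n occ v ≡ parksDesc b n occ v
parksDesc-stuck n occ spot [] = refl
parksDesc-stuck {b = b} n occ spot (x ∷ v) with x ≟ suc b
... | yes refl rewrite vacPark-stuck n occ (toList v) spot | ≰⇒≤ᵇ≡false (1+n≰n {b}) = ∧-zeroʳ _
... | no x≢1+b rewrite ≤ᵇ-suc x≢1+b = refl

parksDesc-street : ∀ {k b n n′} occ occ′ → available n occ ≗ available n′ occ′ → b ≤ n → b ≤ n′ →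
                   (v : Vec ℕ k) → parksDesc b n occ v ≡ parksDesc b n′ occ′ v
parksDesc-street {b = b} occ occ′ same b≤n b≤n′ v with desc≤ b v in desc
... | false = refl
... | true = vacPark-cong occ occ′ same b≤n b≤n′ v (subst T (sym desc) _)

DescPF-[] : ∀ {b n occ} → DescPF 0 b n occ ↔ Fin 1
DescPF-[] = mk↔ₛ′ (λ _ → zero) (λ _ → [] , _) (λ { zero → refl }) (λ { ([] , _) → refl })

DescPF-bound0 : ∀ {k n occ} → ¬ DescPF (suc k) 0 n occ
DescPF-bound0 ((zero ∷ _) , ())
DescPF-bound0 ((suc _ ∷ _) , ())

DescPF-tooFewSpots : ∀ {k b n occ} → free (suc b) occ ≤ k → ¬ DescPF (suc k) b n occ
DescPF-tooFewSpots few (v , p) with desc , parks ← Equivalence.to T-∧ p =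
  1+n≰n (≤-trans (parked≤free v ≤-refl desc parks) few)

DescPF-top : ∀ {k b} n occ {s} → parkingSpot n occ (suc b) ≡ just s →
             DescPF (suc k) (suc b) n occ ↔ (DescPF k (suc b) n (s ∷ occ) ⊎ DescPF (suc k) b n occ)
DescPF-top {b = b} n occ spot =
  ↔-trans (Sub-∷ (suc b))
          (Sub-cong (parksDesc-top n occ spot) ⊎-↔ Sub-cong λ { (x ∷ v) → parksDesc-below n occ x v })

DescPF-forced : ∀ {k b} n occ {s} → free (suc b) occ ≤ k → parkingSpot n occ (suc b) ≡ just s →
                DescPF (suc k) (suc b) n occ ↔ DescPF k (suc b) n (s ∷ occ)
DescPF-forced n occ few spot = ↔-trans (DescPF-top n occ spot) (⊎-emptyʳ (DescPF-tooFewSpots few))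

DescPF-stuck : ∀ {k b} n occ → parkingSpot n occ (suc b) ≡ nothing → DescPF k (suc b) n occ ↔ DescPF k b n occ
DescPF-stuck n occ spot = Sub-cong (parksDesc-stuck n occ spot)

DescPF-street : ∀ {k b n n′} occ occ′ → available n occ ≗ available n′ occ′ → b ≤ n → b ≤ n′ →
                DescPF k b n occ ↔ DescPF k b n′ occ′
DescPF-street occ occ′ same b≤n b≤n′ = Sub-cong (parksDesc-street occ occ′ same b≤n b≤n′)

DescPF-dropTop : ∀ m → DescPF m (2 + m) (2 + m) (1 + m ∷ 2 + m ∷ []) ↔ DescPF m (1 + m) (1 + m) (1 + m ∷ [])
DescPF-dropTop m =
  ↔-trans (DescPF-stuck (2 + m) occ spot)
          (DescPF-street occ (1 + m ∷ []) shrink (n≤1+n _) ≤-refl)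
  where
  occ : List ℕ
  occ = 1 + m ∷ 2 + m ∷ []
  spot : parkingSpot (2 + m) occ (2 + m) ≡ nothing
  spot = parkingSpot-stuck (2 + m) occ m (there (here refl)) (here refl) (available-> occ (≤-refl {3 + m}))
  shrink : available (2 + m) occ ≗ available (1 + m) (1 + m ∷ [])
  shrink = available-∷ (2 + m ∷ []) [] (1 + m) (available-top∷ (1 + m) [])

DescPF-belowTop : ∀ j → DescPF (3 + j) (2 + j) (3 + j) [] ↔ DescPF j (1 + j) (1 + j) (1 + j ∷ [])
DescPF-belowTop j = begin
  DescPF (3 + j) (2 + j) (3 + j) []     ↔⟨ DescPF-forced (3 + j) [] (≤-reflexive (free-[] _)) refl ⟩
  DescPF (2 + j) (2 + j) (3 + j) occ₁   ↔⟨ DescPF-forced (3 + j) occ₁ (≤-reflexive free₁) spot₁ ⟩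
  DescPF (1 + j) (2 + j) (3 + j) occ₂   ↔⟨ DescPF-forced (3 + j) occ₂ (≤-reflexive free₂) spot₂ ⟩
  DescPF j (2 + j) (3 + j) occ₃         ↔⟨ DescPF-stuck (3 + j) occ₃ spot₃ ⟩
  DescPF j (1 + j) (3 + j) occ₃         ↔⟨ DescPF-street occ₃ (1 + j ∷ []) shrink (m≤n+m (1 + j) 2) ≤-refl ⟩
  DescPF j (1 + j) (1 + j) (1 + j ∷ []) ∎
  where
  open EquationalReasoning {k = bijection}
  occ₁ occ₂ occ₃ : List ℕ
  occ₁ = 2 + j ∷ []
  occ₂ = 1 + j ∷ occ₁
  occ₃ = 3 + j ∷ occ₂
  free₁ : free (2 + j) occ₁ ≡ 1 + j
  free₁ = suc-injective (trans (sym (free-park (2 + j) (2 + j) [] (s≤s z≤n) ≤-refl refl)) (free-[] _))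
  free₂ : free (2 + j) occ₂ ≡ j
  free₂ = suc-injective (trans (sym (free-park (2 + j) (1 + j) occ₁ (s≤s z≤n) (n≤1+n _)
                                      (∉⇒unoccupied (1 + j) occ₁ λ { (here ()) ; (there ()) }))) free₁)
  spot₁ : parkingSpot (3 + j) occ₁ (2 + j) ≡ just (1 + j)
  spot₁ = parkingSpot-left (3 + j) occ₁ j (here refl) λ { (here ()) ; (there ()) }
  spot₂ : parkingSpot (3 + j) occ₂ (2 + j) ≡ just (3 + j)
  spot₂ = parkingSpot-right (3 + j) occ₂ j (there (here refl)) (here refl) ≤-refl
            λ { (here ()) ; (there (here ())) ; (there (there ())) }
  spot₃ : parkingSpot (3 + j) occ₃ (2 + j) ≡ nothing
  spot₃ = parkingSpot-stuck (3 + j) occ₃ j (there (there (here refl))) (there (here refl))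
            (trans (available-≤ occ₃ (≤-refl {3 + j})) (cong not (∈⇒occupied occ₃ (here refl))))
  shrink : available (3 + j) occ₃ ≗ available (1 + j) (1 + j ∷ [])
  shrink s = trans (available-top∷ (2 + j) occ₂ s) (available-∷ occ₁ [] (1 + j) (available-top∷ (1 + j) []) s)

vpf↓ topTaken : ℕ → ℕ
vpf↓ zero = 1
vpf↓ (suc zero) = topTaken 0
vpf↓ (suc (suc zero)) = topTaken 1 + 1
vpf↓ (suc (suc (suc j))) = topTaken (suc (suc j)) + topTaken j
topTaken zero = 1
topTaken (suc m) = topTaken m + vpf↓ (suc m)

vpf↓-card : ∀ n → DescPF n n n [] ↔ Fin (vpf↓ n)
topTaken-card : ∀ m → DescPF m (suc m) (suc m) (suc m ∷ []) ↔ Fin (topTaken m)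

vpf↓-card zero = DescPF-[]
vpf↓-card (suc zero) = ↔-trans (DescPF-top 1 [] refl) (↔-trans (⊎-emptyʳ DescPF-bound0) (topTaken-card 0))
vpf↓-card (suc (suc zero)) =
  ↔-trans (DescPF-top 2 [] refl)
    (⊎-Fin (topTaken-card 1)
           (↔-trans (DescPF-forced 2 [] ≤-refl refl) (↔-trans (DescPF-forced 2 (1 ∷ []) z≤n refl) DescPF-[])))
vpf↓-card (suc (suc (suc j))) =
  ↔-trans (DescPF-top (3 + j) [] refl)
    (⊎-Fin (topTaken-card (suc (suc j))) (↔-trans (DescPF-belowTop j) (topTaken-card j)))

topTaken-card zero = DescPF-[]
topTaken-card (suc m) =
  ↔-trans (DescPF-top (2 + m) (2 + m ∷ []) spot)
    (⊎-Fin (↔-trans (DescPF-dropTop m) (topTaken-card m))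
           (↔-trans (DescPF-street (2 + m ∷ []) [] (available-top∷ (1 + m) []) (n≤1+n _) ≤-refl) (vpf↓-card (suc m))))
  where
  spot : parkingSpot (2 + m) (2 + m ∷ []) (2 + m) ≡ just (1 + m)
  spot = parkingSpot-left (2 + m) (2 + m ∷ []) m (here refl) λ { (here ()) ; (there ()) }

VPFdown↔DescPF : ∀ n → VPFdown n ↔ DescPF n n n []
VPFdown↔DescPF n = mk↔ₛ′ to from (λ _ → Sub-≡ refl) from∘to
  where
  to : VPFdown n → DescPF n n n []
  to (v , (inRange , parks) , linked) =
    v , Equivalence.from T-∧ (desc≤-complete (All.map proj₁ inRange) (topLinked inRange linked) ,
                              Equivalence.from T-≡ parks)
    where
    topLinked : ∀ {k} {u : Vec ℕ k} → All (InRange n) u → Linked _≥_ (toList u) → Linked _≥_ (n ∷ toList u)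
    topLinked [] _ = [-]
    topLinked ((_ , x≤n) ∷ _) linked = x≤n ∷ linked
  from : DescPF n n n [] → VPFdown n
  from (v , p) with desc , parks ← Equivalence.to T-∧ p with inRange , linked ← desc≤-sound v desc =
    v , (inRange , Equivalence.to T-≡ parks) , Linked.tail linked
  from∘to : ∀ x → from (to x) ≡ x
  from∘to (v , (inRange , parks) , linked) =
    cong (v ,_) (cong₂ _,_ (cong₂ _,_ (All.irrelevant InRange-irrelevant _ _) (Bool-UIP _ _))
                           (Linked.irrelevant ≤-irrelevant _ _))
    where
    InRange-irrelevant : ∀ {a} (p q : InRange n a) → p ≡ q
    InRange-irrelevant (p₁ , p₂) (q₁ , q₂) = cong₂ _,_ (≤-irrelevant p₁ q₁) (≤-irrelevant p₂ q₂)
    open Decidable⇒UIP Bool._≟_ renaming (≡-irrelevant to Bool-UIP)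

VPFdown-card : ∀ n → VPFdown n ↔ Fin (vpf↓ n)
VPFdown-card n = ↔-trans (VPFdown↔DescPF n) (vpf↓-card n)

vpf↓-unique : ∀ {n a} → VPFdown n ↔ Fin a → a ≡ vpf↓ n
vpf↓-unique {n} VPF↓≅a = ↔⇒≡ (↔-trans (↔-sym VPF↓≅a) (VPFdown-card n))

vpf↓-recurrence : ∀ j → vpf↓ (4 + j) ≡ 2 * vpf↓ (3 + j) + vpf↓ (1 + j)
vpf↓-recurrence j = regroup (topTaken (2 + j)) (topTaken j) (vpf↓ (1 + j))
  where
  regroup : ∀ t₂ t₀ v₁ → (t₂ + (t₂ + t₀)) + (t₀ + v₁) ≡ 2 * (t₂ + t₀) + v₁
  regroup = solve-∀

theorem3p6 : ((n a b c : ℕ) → 4 ≤ n →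
                (VPFdown n ↔ Fin a) → (VPFdown (n ∸ 1) ↔ Fin b) → (VPFdown (n ∸ 3) ↔ Fin c) →
                a ≡ 2 * b + c)
             × (VPFdown 1 ↔ Fin 1) × (VPFdown 2 ↔ Fin 3) × (VPFdown 3 ↔ Fin 6)
theorem3p6 = recurrence , VPFdown-card 1 , VPFdown-card 2 , VPFdown-card 3
  where
  recurrence : (n a b c : ℕ) → 4 ≤ n →
               (VPFdown n ↔ Fin a) → (VPFdown (n ∸ 1) ↔ Fin b) → (VPFdown (n ∸ 3) ↔ Fin c) → a ≡ 2 * b + c
  recurrence (suc (suc (suc (suc j)))) a b c (s≤s (s≤s (s≤s (s≤s _)))) ≅a ≅b ≅c
    rewrite vpf↓-unique ≅a | vpf↓-unique ≅b | vpf↓-unique ≅c = vpf↓-recurrence j
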